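{- Let $\lambda\supseteq\mu$ be partitions and $\mathcal{I}$ an interval set of $\lambda/\mu$. If $T$ and $T'$ are two border strip tableaux of shape $\lambda/\mu$ corresponding to $\mathcal{I}$, then $\mathrm{ht}(T)\equiv\mathrm{ht}(T')\pmod 2$.
   Context: Skew diagram $\lambda/\mu=\{(i,j):\mu_i<j\le\lambda_i\}$; square $(i,j)$ drawn as $[j-1,j]\times[-i,-i+1]$. $r=\mathrm{rank}(\lambda/\mu)$: an outside top corner is $(i,j)\in\lambda/\mu$ with $(i-1,j),(i,j-1)\notin\lambda/\mu$; an inside top corner is $(i,j)\in\lambda/\mu$ with $(i-1,j),(i,j-1)\in\lambda/\mu$, $(i-1,j-1)\notin\lambda/\mu$; the diagonal of corner $(i,j)$ is $\{(i+p,j+p)\in\lambda/\mu:p\ge0\}$; rank = number of squares on outside diagonals minus number on inside diagonals. A border strip is a nonempty edge-connected skew diagram with no $2\times2$ block; its height $\mathrm{ht}(B)$ is the number of rows it meets minus one. A border strip tableau of shape $\lambda/\mu$ is a chain $\mu=\lambda^0\subset\cdots\subset\lambda^m=\lambda$ with each $\lambda^i/\lambda^{i-1}$ a border strip; $\mathrm{ht}(T)=\sum_i\mathrm{ht}(\lambda^i/\lambda^{i-1})$. Code: for a partition $\alpha$, its boundary path goes up $x=0$ from $y=-\infty$ to $(0,-\ell(\alpha))$, follows the lower-right boundary of $\alpha$ to $(\alpha_1,0)$, then right along $y=0$; the step starting at $(x,y)$ has index $x+y$; $\mathrm{code}(\alpha)_k=1$ if step $k$ is horizontal, $0$ if vertical.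 If $\beta\subseteq\alpha$ and $\alpha/\beta$ is a border strip of $p$ squares, $\mathrm{code}(\alpha)$ and $\mathrm{code}(\beta)$ differ in exactly two positions $u<v=u+p$. $T$ corresponds to $\mathcal{I}$ if $\mathcal{I}$ is exactly the set of pairs $(u,v)$ obtained in this way from the steps $\lambda^{i-1}\subset\lambda^i$ of $T$. Snakes: for $k\in\mathbb{Z}$ let $e_k$ be step $k$ of the path of $\lambda$. If $e_k$ is also a step of the path of $\mu$, $S_k=\emptyset$. Otherwise, if $e_k$ is horizontal it is the lower edge of $(i,j)\in\lambda/\mu$ and $S_k=(\lambda/\mu)\cap\{(i,j),(i,j-1),(i-1,j-1),(i-1,j-2),\dots\}$; if vertical it is the right edge of $(i,j)\in\lambda/\mu$ and $S_k=(\lambda/\mu)\cap\{(i,j),(i-1,j),(i-1,j-1),(i-2,j-1),\dots\}$. $\ell(S_k)=|S_k|-1$. $S_k$ is a left snake if $e_k$ horizontal and $\ell(S_k)\ge0$ even; a right snake if $e_k$ vertical and $\ell(S_k)\ge0$ even. An interval set is a set of $r$ pairs $(u_i,v_i)$ of integers, the $2r$ integers distinct, $u_i<v_i$, each $S_{u_i}$ a left snake and each $S_{v_i}$ a right snake. -}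

module Defs where

open import Data.Bool using (Bool; true; false; _∧_; not; if_then_else_; T)
open import Data.Nat as ℕ using (ℕ; zero; suc)
open import Data.Integer as ℤ using (ℤ; +_; -_; _+_; _-_; 0ℤ; 1ℤ; ∣_∣; _≤ᵇ_)
open import Data.Integer.Divisibility using () renaming (_∣_ to _∣ℤ_)
open import Data.List using (List; []; _∷_; length; map; concatMap; sum)
open import Data.List.Relation.Unary.All using (All)
open import Data.List.Relation.Unary.Any using (Any)
open import Data.List.Relation.Unary.Linked using (Linked)
open import Data.List.Relation.Unary.Unique.Propositional using (Unique)
open import Data.List.Membership.Propositional using (_∈_)
open import Data.Product using (Σ; ∃; ∃-syntax; _×_; _,_)
open import Data.Sum using (_⊎_)
open import Relation.Nullary using (¬_)
open import Relation.Binary.PropositionalEquality using (_≡_)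
open import Function.Bundles using (_⇔_)

IsPartition : List ℕ → Set
IsPartition α = All (0 ℕ.<_) α × Linked ℕ._≥_ α

-- the 1-indexed part α_i (0 beyond the length, and for i = 0)
part : List ℕ → ℕ → ℕ
part []      _             = 0
part (a ∷ α) zero          = 0
part (a ∷ α) (suc zero)    = a
part (a ∷ α) (suc (suc i)) = part α (suc i)

partℤ : List ℕ → ℤ → ℤ
partℤ α (+ i)    = + part α i
partℤ α ℤ.-[1+ _ ] = 0ℤ

_⊆ₚ_ : List ℕ → List ℕ → Set
β ⊆ₚ α = ∀ i → part β i ℕ.≤ part α i

_<ᵇ_ : ℤ → ℤ → Bool
a <ᵇ b = (a + 1ℤ) ≤ᵇ b

inSkew : List ℕ → List ℕ → ℤ → ℤ → Bool
inSkew α β i j = (1ℤ ≤ᵇ i) ∧ (partℤ β i <ᵇ j) ∧ (j ≤ᵇ partℤ α i)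

InSkew : List ℕ → List ℕ → ℤ → ℤ → Set
InSkew α β i j = T (inSkew α β i j)

count : (ℤ → Bool) → ℤ → ℕ → ℕ
count f a zero    = 0
count f a (suc n) = (if f a then 1 else 0) ℕ.+ count f (a + 1ℤ) n

sumℤ : (ℤ → ℤ) → ℤ → ℕ → ℤ
sumℤ f a zero    = 0ℤ
sumℤ f a (suc n) = f a + sumℤ f (a + 1ℤ) n

module _ (λ' μ : List ℕ) where
  private
    inn : ℤ → ℤ → Bool
    inn = inSkew λ' μ
    L = length λ'
    W = part λ' 1

  outsideTopCorner : ℤ → ℤ → Bool
  outsideTopCorner i j = inn i j ∧ not (inn (i - 1ℤ) j) ∧ not (inn i (j - 1ℤ))

  insideTopCorner : ℤ → ℤ → Bool
  insideTopCorner i j =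
    inn i j ∧ inn (i - 1ℤ) j ∧ inn i (j - 1ℤ) ∧ not (inn (i - 1ℤ) (j - 1ℤ))

  -- number of squares on the diagonal {(i+p, j+p) ∈ λ/μ : p ≥ 0}
  -- (p ≤ L suffices, since i ≥ 1 and i + p ≤ L for a square of λ)
  diagSize : ℤ → ℤ → ℕ
  diagSize i j = count (λ p → inn (i + p) (j + p)) 0ℤ (suc L)

  -- all squares of λ/μ lie in rows 1..L and columns 1..W
  rank : ℤ
  rank = sumℤ (λ i → sumℤ (λ j →
           (if outsideTopCorner i j then + diagSize i j else 0ℤ)
           - (if insideTopCorner i j then + diagSize i j else 0ℤ)) 1ℤ W) 1ℤ L

Adjacent : ℤ × ℤ → ℤ × ℤ → Set
Adjacent (i , j) (i' , j') = ∣ i - i' ∣ ℕ.+ ∣ j - j' ∣ ≡ 1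

data Reach (α β : List ℕ) : ℤ × ℤ → ℤ × ℤ → Set where
  here : ∀ {i j} → InSkew α β i j → Reach α β (i , j) (i , j)
  step : ∀ {i j c d} → InSkew α β i j → Adjacent (i , j) c →
         Reach α β c d → Reach α β (i , j) d

IsBorderStrip : List ℕ → List ℕ → Set
IsBorderStrip α β =
  β ⊆ₚ α
  × (∃[ i ] ∃[ j ] InSkew α β i j)
  × (∀ i j i' j' → InSkew α β i j → InSkew α β i' j' → Reach α β (i , j) (i' , j'))
  × (¬ (∃[ i ] ∃[ j ] (InSkew α β i j × InSkew α β (i + 1ℤ) j
                        × InSkew α β i (j + 1ℤ) × InSkew α β (i + 1ℤ) (j + 1ℤ))))

rowsMet : List ℕ → List ℕ → ℕ
rowsMet α β = count (λ i → partℤ β i <ᵇ partℤ α i) 1ℤ (length α)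

htStrip : List ℕ → List ℕ → ℕ
htStrip α β = rowsMet α β ℕ.∸ 1

data BST (μ : List ℕ) : List ℕ → Set where
  start : BST μ μ
  extend : ∀ {β} → BST μ β → (α : List ℕ) → IsPartition α →
           IsBorderStrip α β → BST μ α

steps : ∀ {μ λ'} → BST μ λ' → List (List ℕ × List ℕ)
steps start = []
steps (extend {β} T α _ _) = (β , α) ∷ steps T

ht : ∀ {μ λ'} → BST μ λ' → ℕ
ht start = 0
ht (extend {β} T α _ _) = htStrip α β ℕ.+ ht T

data Dir : Set where
  H V : Dir

-- OnPath α x y d : the boundary path of α has a step starting at (x,y)
-- in direction d (H: to (x+1,y); V: to (x,y+1)).  Its index is x + y.
data OnPath (α : List ℕ) : ℤ → ℤ → Dir → Set where
  -- up along x = 0 from y = -∞ to (0, -ℓ(α))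
  tailV : ∀ {y} → (y + 1ℤ) ℤ.≤ - (+ length α) → OnPath α 0ℤ y V
  -- right along y = 0 from (α₁, 0)
  tailH : ∀ {x} → + part α 1 ℤ.≤ x → OnPath α x 0ℤ H
  -- lower-right boundary: bottom of row i from x = α_{i+1} to x = α_i
  rowH : ∀ {i x} → 1 ℕ.≤ i → i ℕ.≤ length α →
         + part α (suc i) ℤ.≤ x → x ℤ.< + part α i → OnPath α x (- (+ i)) H
  -- ... then up the right end of row i
  rowV : ∀ {i} → 1 ℕ.≤ i → i ℕ.≤ length α → OnPath α (+ part α i) (- (+ i)) V

-- code(α)_k = 1  iff step k of the path is horizontal
CodeOne : List ℕ → ℤ → Set
CodeOne α k = ∃[ x ] ∃[ y ] (x + y ≡ k × OnPath α x y H)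

CodeDiffer : List ℕ → List ℕ → ℤ → Set
CodeDiffer α β k = ¬ (CodeOne α k ⇔ CodeOne β k)

StepPair : List ℕ → List ℕ → ℤ → ℤ → Set
StepPair β α u v =
  u ℤ.< v × CodeDiffer α β u × CodeDiffer α β v
  × (∀ k → CodeDiffer α β k → k ≡ u ⊎ k ≡ v)

Corresponds : ∀ {μ λ'} → BST μ λ' → List (ℤ × ℤ) → Set
Corresponds T I =
  ∀ u v → (Any (λ { (β , α) → StepPair β α u v }) (steps T) ⇔ (u , v) ∈ I)

module _ (λ' μ : List ℕ) where
  private
    inn : ℤ → ℤ → Bool
    inn = inSkew λ' μ

  -- |S_k| when e_k is horizontal, starting at (x,y): lower edge of (i,j),
  -- i = -y, j = x + 1; cells (i,j),(i,j-1),(i-1,j-1),(i-1,j-2),…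
  -- i.e. (i-s, j-s) and (i-s, j-s-1) for s ≥ 0 (s ≤ |y| suffices).
  snakeSizeH : ℤ → ℤ → ℕ
  snakeSizeH x y =
    count (λ s → inn (i - s) (j - s)) 0ℤ (suc ∣ y ∣)
    ℕ.+ count (λ s → inn (i - s) (j - s - 1ℤ)) 0ℤ (suc ∣ y ∣)
    where i = - y ; j = x + 1ℤ

  -- |S_k| when e_k is vertical, starting at (x,y): right edge of (i,j),
  -- i = -y, j = x; cells (i,j),(i-1,j),(i-1,j-1),(i-2,j-1),…
  -- i.e. (i-s, j-s) and (i-s-1, j-s) for s ≥ 0.
  snakeSizeV : ℤ → ℤ → ℕ
  snakeSizeV x y =
    count (λ s → inn (i - s) (j - s)) 0ℤ (suc ∣ y ∣)
    ℕ.+ count (λ s → inn (i - s - 1ℤ) (j - s)) 0ℤ (suc ∣ y ∣)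
    where i = - y ; j = x

  GoodLength : ℕ → Set
  GoodLength n = (0ℤ ℤ.≤ (+ n - 1ℤ)) × (+ 2 ∣ℤ (+ n - 1ℤ))

  -- S_k is a left snake: e_k horizontal, not a step of μ's path
  -- (otherwise S_k = ∅, ℓ = -1), and ℓ(S_k) ≥ 0 even
  LeftSnake : ℤ → Set
  LeftSnake k = ∃[ x ] ∃[ y ] (x + y ≡ k × OnPath λ' x y H
                  × ¬ OnPath μ x y H × GoodLength (snakeSizeH x y))

  RightSnake : ℤ → Set
  RightSnake k = ∃[ x ] ∃[ y ] (x + y ≡ k × OnPath λ' x y V
                  × ¬ OnPath μ x y V × GoodLength (snakeSizeV x y))

  IsIntervalSet : List (ℤ × ℤ) → Set
  IsIntervalSet I =
    (+ length I ≡ rank λ' μ)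
    × Unique (concatMap (λ { (u , v) → u ∷ v ∷ [] }) I)
    × All (λ { (u , v) → u ℤ.< v × LeftSnake u × RightSnake v }) I

-- Encode a partition α by its Maya diagram: the "particles" maya α n = α_{n+1} - (n + 1) are the
-- indices of the vertical steps of its boundary path. Adding a border strip α/β makes exactly one
-- particle jump, from u = maya β (last row of the strip) to v = maya α (first row), so (u, v) is the
-- pair where the codes of β and α differ, and the height of the strip is the number of particles of β
-- strictly between u and v. Hence ht T mod 2 is the parity of the number of particles jumped over
-- along a walk of jumps whose pairs all lie in 𝓘.
--
-- Mark each pair of 𝓘 used an odd number of times. As the 2r endpoints are distinct, the marking is
-- read off from the final configuration (that of λ), and the parity of the walk is the quadratic form
-- Σ_{s marked} (N(s) + Σ_{t marked, after s in 𝓘} cr(t, s)), where N(s) counts particles of μ inside s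
-- and cr(t, s) endpoints of t inside s. Flipping the mark of s changes this form by the current number
-- of particles inside s because cr is symmetric for intervals with distinct endpoints (both sides
-- say whether the intervals cross). So the parity only depends on μ, λ and 𝓘.

module Submission where

open import Defs
open import Data.Nat using (ℕ; _%_)
open import Data.Integer using (ℤ)
open import Data.List using (List)
open import Data.Product using (_×_)
open import Relation.Binary.PropositionalEquality using (_≡_)

open import Algebra.Solver.Ring.AlmostCommutativeRing using (fromCommutativeRing)
open import Data.Bool using (Bool; true; false; _∧_; not; _xor_; if_then_else_)
open import Data.Bool.Properties as Bool using (xor-∧-commutativeRing)
open import Data.Empty using (⊥-elim)
open import Data.Integer using (+_; -[1+_]; 0ℤ; 1ℤ; ∣_∣; _+_; _-_; -_; _≤_; _<_) renaming (suc to sucℤ)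
import Data.Integer as ℤ
import Data.Integer.Properties as ℤ
open import Data.Integer.Tactic.RingSolver using (solve-∀)
open import Data.List using (_∷_; []; _++_; length; concatMap)
open import Data.List.Membership.Propositional using (_∈_)
open import Data.List.Relation.Unary.All as All using (All; _∷_; [])
open import Data.List.Relation.Unary.AllPairs using (_∷_)
open import Data.List.Relation.Unary.Any as Any using (here; there)
open import Data.List.Relation.Unary.Linked using (Linked; _∷_)
open import Data.List.Relation.Unary.Unique.Propositional using (Unique)
open import Data.Nat as ℕ using (zero; suc)
open import Data.Nat.DivMod using ([m+n]%n≡m%n)
import Data.Nat.Properties as ℕ
open import Data.Product using (_,_; proj₁; proj₂; ∃-syntax)
open import Data.Sum using (_⊎_; inj₁; inj₂; [_,_])
open import Data.Unit using (⊤; tt)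
open import Function using (_∘_; id; _⇔_; mk⇔; Equivalence)
open import Relation.Binary.Definitions using (tri<; tri≈; tri>)
open import Relation.Binary.PropositionalEquality
  using (refl; sym; trans; cong; cong₂; subst; _≢_; ≢-sym; _≗_; module ≡-Reasoning)
open import Relation.Nullary using (¬_; Dec; does; yes; no)
open import Relation.Nullary.Decidable as Dec using (dec-true; dec-false)

open import Algebra.Solver.Ring.Simple (fromCommutativeRing xor-∧-commutativeRing) Bool._≟_
  using (solve; _:+_; _:*_; _:=_; con)

parity : ℕ → Bool
parity zero    = false
parity (suc n) = not (parity n)

parity-+ : ∀ m n → parity (m ℕ.+ n) ≡ parity m xor parity n
parity-+ zero    n = refl
parity-+ (suc m) n = trans (cong not (parity-+ m n)) (Bool.not-distribˡ-xor (parity m) (parity n))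

%2≡parity : ∀ n → n % 2 ≡ (if parity n then 1 else 0)
%2≡parity zero          = refl
%2≡parity (suc zero)    = refl
%2≡parity (suc (suc n)) = begin
  (2 ℕ.+ n) % 2                        ≡⟨ cong (_% 2) (ℕ.+-comm 2 n) ⟩
  (n ℕ.+ 2) % 2                        ≡⟨ [m+n]%n≡m%n n 2 ⟩
  n % 2                                ≡⟨ %2≡parity n ⟩
  (if parity n then 1 else 0)          ≡⟨ cong (if_then 1 else 0) (sym (Bool.not-involutive (parity n))) ⟩
  (if parity (suc (suc n)) then 1 else 0) ∎
  where open ≡-Reasoning

parity⇒%2 : ∀ {m n} → parity m ≡ parity n → m % 2 ≡ n % 2
parity⇒%2 {m} {n} eq = trans (%2≡parity m) (trans (cong (if_then 1 else 0) eq) (sym (%2≡parity n)))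

i<sucℤ[i] : ∀ i → i < sucℤ i
i<sucℤ[i] i = ℤ.suc[i]≤j⇒i<j ℤ.≤-refl

sucℤ[a]+i≡a+suc[i] : ∀ a i → sucℤ a + + i ≡ a + + suc i
sucℤ[a]+i≡a+suc[i] a i = shift a (+ i)
  where
  shift : ∀ a x → (1ℤ + a) + x ≡ a + (1ℤ + x)
  shift = solve-∀

[a+1]+i≡a+suc[i] : ∀ a i → (a + 1ℤ) + + i ≡ a + + suc i
[a+1]+i≡a+suc[i] a i = shift a (+ i)
  where
  shift : ∀ a x → (a + 1ℤ) + x ≡ a + (1ℤ + x)
  shift = solve-∀

i+∣j-i∣≡j : ∀ {i j} → i ≤ j → i + + ∣ j - i ∣ ≡ j
i+∣j-i∣≡j {i} {j} i≤j = trans (cong (λ d → i + d) (ℤ.0≤i⇒+∣i∣≡i (ℤ.i≤j⇒0≤j-i i≤j))) (i+[j-i]≡j i j)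
  where
  i+[j-i]≡j : ∀ i j → i + (j - i) ≡ j
  i+[j-i]≡j = solve-∀

+x+1≡+suc[x] : ∀ x → + x + 1ℤ ≡ + suc x
+x+1≡+suc[x] x = cong +_ (ℕ.+-comm x 1)

[a-s]+s≡a : ∀ a s → (a - s) + s ≡ a
[a-s]+s≡a = solve-∀

a-sucℤ[s]<k⇒a≤k+s : ∀ {a s k} → a - sucℤ s < k → a ≤ k + s
a-sucℤ[s]<k⇒a≤k+s {a} {s} {k} lt = subst (_≤ k + s) ([a-s]+s≡a a s)
  (ℤ.+-monoˡ-≤ s (subst (_≤ k) (shift a s) (ℤ.i<j⇒suc[i]≤j lt)))
  where
  shift : ∀ a s → 1ℤ + (a - (1ℤ + s)) ≡ a - s
  shift = solve-∀

k<a-s⇒k+s<a : ∀ {a s k} → k < a - s → k + s < a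
k<a-s⇒k+s<a {a} {s} {k} lt = subst (k + s <_) ([a-s]+s≡a a s) (ℤ.+-monoˡ-< s lt)

-[1+n]<-m : ∀ {m n} → m ℕ.≤ n → -[1+ n ] < - + m
-[1+n]<-m {zero}  _   = ℤ.-<+
-[1+n]<-m {suc m} m<n = ℤ.-<- m<n

_==_ : ℤ → ℤ → Bool
x == y = does (x ℤ.≟ y)

<?-flip : ∀ {a b} → a ≢ b → does (b ℤ.<? a) ≡ not (does (a ℤ.<? b))
<?-flip {a} {b} a≢b with a ℤ.<? b | b ℤ.<? a
... | yes a<b | yes b<a = ⊥-elim (ℤ.<-asym a<b b<a)
... | yes _   | no _    = refl
... | no _    | yes _   = refl
... | no a≮b  | no b≮a  = ⊥-elim (a≮b (ℤ.≤∧≢⇒< (ℤ.≮⇒≥ b≮a) a≢b))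

xorFrom : (ℤ → Bool) → ℤ → ℕ → Bool
xorFrom f a zero    = false
xorFrom f a (suc n) = f a xor xorFrom f (sucℤ a) n

xorFrom-cong : ∀ {f g} → f ≗ g → ∀ a n → xorFrom f a n ≡ xorFrom g a n
xorFrom-cong f≗g a zero    = refl
xorFrom-cong f≗g a (suc n) = cong₂ _xor_ (f≗g a) (xorFrom-cong f≗g (sucℤ a) n)

xorFrom-xor : ∀ f g a n → xorFrom (λ k → f k xor g k) a n ≡ xorFrom f a n xor xorFrom g a n
xorFrom-xor f g a zero    = refl
xorFrom-xor f g a (suc n) rewrite xorFrom-xor f g (sucℤ a) n =
  solve 4 (λ x y z w → (x :+ y) :+ (z :+ w) := (x :+ z) :+ (y :+ w)) refl
    (f a) (g a) (xorFrom f (sucℤ a) n) (xorFrom g (sucℤ a) n)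

xorFrom-∧ : ∀ d f a n → xorFrom (λ k → d ∧ f k) a n ≡ d ∧ xorFrom f a n
xorFrom-∧ d f a zero    = sym (Bool.∧-zeroʳ d)
xorFrom-∧ d f a (suc n) rewrite xorFrom-∧ d f (sucℤ a) n =
  sym (Bool.∧-distribˡ-xor d (f a) (xorFrom f (sucℤ a) n))

xorFrom-+ : ∀ f a m n → xorFrom f a (m ℕ.+ n) ≡ xorFrom f a m xor xorFrom f (a + + m) n
xorFrom-+ f a zero    n = cong (λ b → xorFrom f b n) (sym (ℤ.+-identityʳ a))
xorFrom-+ f a (suc m) n = begin
  f a xor xorFrom f (sucℤ a) (m ℕ.+ n)
    ≡⟨ cong (f a xor_) (xorFrom-+ f (sucℤ a) m n) ⟩
  f a xor (xorFrom f (sucℤ a) m xor xorFrom f (sucℤ a + + m) n)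
    ≡⟨ sym (Bool.xor-assoc (f a) _ _) ⟩
  (f a xor xorFrom f (sucℤ a) m) xor xorFrom f (sucℤ a + + m) n
    ≡⟨ cong (λ b → (f a xor xorFrom f (sucℤ a) m) xor xorFrom f b n) (sucℤ[a]+i≡a+suc[i] a m) ⟩
  (f a xor xorFrom f (sucℤ a) m) xor xorFrom f (a + + suc m) n ∎
  where open ≡-Reasoning

xorFrom-false : ∀ f a n → (∀ k → a ≤ k → k < a + + n → f k ≡ false) → xorFrom f a n ≡ false
xorFrom-false f a zero    _       = refl
xorFrom-false f a (suc n) f≡false = cong₂ _xor_
  (f≡false a ℤ.≤-refl (subst (a <_) (sucℤ[a]+i≡a+suc[i] a n)
    (ℤ.<-≤-trans (i<sucℤ[i] a) (ℤ.i≤i+j (sucℤ a) (+ n)))))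
  (xorFrom-false f (sucℤ a) n λ k a<k k<a+n →
    f≡false k (ℤ.<⇒≤ (ℤ.suc[i]≤j⇒i<j a<k)) (subst (k <_) (sucℤ[a]+i≡a+suc[i] a n) k<a+n))

-- The xor of f over [x, y); junk when y < x.
xorBetween : (ℤ → Bool) → ℤ → ℤ → Bool
xorBetween f x y = xorFrom f x ∣ y - x ∣

xorBetween-split : ∀ f {x y w} → x ≤ y → y ≤ w →
                   xorBetween f x w ≡ xorBetween f x y xor xorBetween f y w
xorBetween-split f {x} {y} {w} x≤y y≤w = begin
  xorFrom f x ∣ w - x ∣                                   ≡⟨ cong (xorFrom f x) ∣w-x∣≡∣y-x∣+∣w-y∣ ⟩
  xorFrom f x (∣ y - x ∣ ℕ.+ ∣ w - y ∣)                   ≡⟨ xorFrom-+ f x ∣ y - x ∣ ∣ w - y ∣ ⟩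
  xorBetween f x y xor xorFrom f (x + + ∣ y - x ∣) ∣ w - y ∣
    ≡⟨ cong (λ a → xorBetween f x y xor xorFrom f a ∣ w - y ∣) (i+∣j-i∣≡j x≤y) ⟩
  xorBetween f x y xor xorBetween f y w                   ∎
  where
  open ≡-Reasoning
  w-x≡[y-x]+[w-y] : ∀ x y w → w - x ≡ (y - x) + (w - y)
  w-x≡[y-x]+[w-y] = solve-∀
  ∣w-x∣≡∣y-x∣+∣w-y∣ : ∣ w - x ∣ ≡ ∣ y - x ∣ ℕ.+ ∣ w - y ∣
  ∣w-x∣≡∣y-x∣+∣w-y∣ = ℤ.+-injective (begin
    + ∣ w - x ∣                 ≡⟨ ℤ.0≤i⇒+∣i∣≡i (ℤ.i≤j⇒0≤j-i (ℤ.≤-trans x≤y y≤w)) ⟩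
    w - x                       ≡⟨ w-x≡[y-x]+[w-y] x y w ⟩
    (y - x) + (w - y)           ≡⟨ sym (cong₂ _+_ (ℤ.0≤i⇒+∣i∣≡i (ℤ.i≤j⇒0≤j-i x≤y))
                                                   (ℤ.0≤i⇒+∣i∣≡i (ℤ.i≤j⇒0≤j-i y≤w))) ⟩
    + ∣ y - x ∣ + + ∣ w - y ∣   ∎)

xorBetween-empty : ∀ f x → xorBetween f x x ≡ false
xorBetween-empty f x rewrite ℤ.+-inverseʳ x = refl

xorBetween-single : ∀ f x → xorBetween f x (sucℤ x) ≡ f x
xorBetween-single f x =
  trans (cong (λ d → xorFrom f x ∣ d ∣) ([1+x]-x≡1 x)) (Bool.xor-identityʳ (f x))
  where
  [1+x]-x≡1 : ∀ x → (1ℤ + x) - x ≡ 1ℤ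
  [1+x]-x≡1 = solve-∀

xorBetween-false : ∀ f {x y} → x ≤ y → (∀ k → x ≤ k → k < y → f k ≡ false) →
                   xorBetween f x y ≡ false
xorBetween-false f {x} {y} x≤y f≡false = xorFrom-false f x ∣ y - x ∣ λ k x≤k k<y →
  f≡false k x≤k (subst (k <_) (i+∣j-i∣≡j x≤y) k<y)

count-+ : ∀ f a m n → count f a (m ℕ.+ n) ≡ count f a m ℕ.+ count f (a + + m) n
count-+ f a zero    n = cong (λ b → count f b n) (sym (ℤ.+-identityʳ a))
count-+ f a (suc m) n = begin
  fa ℕ.+ count f (a + 1ℤ) (m ℕ.+ n)
    ≡⟨ cong (fa ℕ.+_) (count-+ f (a + 1ℤ) m n) ⟩
  fa ℕ.+ (count f (a + 1ℤ) m ℕ.+ count f ((a + 1ℤ) + + m) n)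
    ≡⟨ sym (ℕ.+-assoc fa _ _) ⟩
  (fa ℕ.+ count f (a + 1ℤ) m) ℕ.+ count f ((a + 1ℤ) + + m) n
    ≡⟨ cong (λ b → (fa ℕ.+ count f (a + 1ℤ) m) ℕ.+ count f b n) ([a+1]+i≡a+suc[i] a m) ⟩
  (fa ℕ.+ count f (a + 1ℤ) m) ℕ.+ count f (a + + suc m) n ∎
  where
  open ≡-Reasoning
  fa = if f a then 1 else 0

module _ (f : ℤ → Bool) (b : Bool) where

  first-offset : ∀ {a n} → (∀ i → i ℕ.< suc n → f (a + + i) ≡ b) → f a ≡ b
  first-offset {a} f≡b = subst (λ x → f x ≡ b) (ℤ.+-identityʳ a) (f≡b 0 (ℕ.s≤s ℕ.z≤n))

  later-offsets : ∀ {a n} → (∀ i → i ℕ.< suc n → f (a + + i) ≡ b) →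
                  ∀ i → i ℕ.< n → f ((a + 1ℤ) + + i) ≡ b
  later-offsets {a} f≡b i i<n = subst (λ x → f x ≡ b) (sym ([a+1]+i≡a+suc[i] a i)) (f≡b (suc i) (ℕ.s≤s i<n))

count-false : ∀ f a n → (∀ i → i ℕ.< n → f (a + + i) ≡ false) → count f a n ≡ 0
count-false f a zero    _       = refl
count-false f a (suc n) f≡false = cong₂ (λ x c → (if x then 1 else 0) ℕ.+ c)
  (first-offset f false {a} f≡false) (count-false f (a + 1ℤ) n (later-offsets f false {a} f≡false))

count-true : ∀ f a n → (∀ i → i ℕ.< n → f (a + + i) ≡ true) → count f a n ≡ n
count-true f a zero    _      = refl
count-true f a (suc n) f≡true = cong₂ (λ x c → (if x then 1 else 0) ℕ.+ c)
  (first-offset f true {a} f≡true) (count-true f (a + 1ℤ) n (later-offsets f true {a} f≡true))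

module _ {P : ℕ → Set} (P? : ∀ n → Dec (P n)) where

  least : ∀ {r} → P r → ∃[ j ] (P j × (∀ n → n ℕ.< j → ¬ P n))
  least {r} = below-fuel (suc r) ℕ.≤-refl
    where
    below-fuel : ∀ fuel {r} → r ℕ.< fuel → P r → ∃[ j ] (P j × (∀ n → n ℕ.< j → ¬ P n))
    below-fuel (suc fuel) {r} (ℕ.s≤s r≤fuel) Pr with ℕ.anyUpTo? P? r
    ... | no  none              = r , Pr , λ n n<r Pn → none (n , n<r , Pn)
    ... | yes (n , n<r , Pn)    = below-fuel fuel (ℕ.<-≤-trans n<r r≤fuel) Pn

  greatest : ∀ B → (∀ n → P n → n ℕ.< B) → ∀ {r} → P r → ∃[ m ] (P m × (∀ n → m ℕ.< n → ¬ P n))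
  greatest zero    bounded Pr = ⊥-elim (ℕ.n≮0 (bounded _ Pr))
  greatest (suc B) bounded Pr with P? B
  ... | yes PB  = B , PB , λ n B<n Pn → ℕ.<-irrefl refl (ℕ.<-≤-trans (bounded n Pn) B<n)
  ... | no  ¬PB = greatest B (λ n Pn → ℕ.≤∧≢⇒< (ℕ.s≤s⁻¹ (bounded n Pn)) λ { refl → ¬PB Pn }) Pr

module StrictlyDecreasing {z : ℕ → ℤ} (z-step : ∀ n → z (suc n) < z n) where

  z-< : ∀ {m n} → m ℕ.< n → z n < z m
  z-< {m} {suc n} (ℕ.s≤s m≤n) with ℕ.m≤n⇒m<n∨m≡n m≤n
  ... | inj₁ m<n  = ℤ.<-trans (z-step n) (z-< m<n)
  ... | inj₂ refl = z-step n

  z-≤ : ∀ {m n} → m ℕ.≤ n → z n ≤ z m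
  z-≤ m≤n with ℕ.m≤n⇒m<n∨m≡n m≤n
  ... | inj₁ m<n  = ℤ.<⇒≤ (z-< m<n)
  ... | inj₂ refl = ℤ.≤-refl

  gap-missed : ∀ {k m} → z (suc m) < k → k < z m → ∀ n → z n ≢ k
  gap-missed {k} {m} zsm<k k<zm n refl with n ℕ.≤? m
  ... | yes n≤m = ℤ.<-irrefl refl (ℤ.<-≤-trans k<zm (z-≤ n≤m))
  ... | no  n≰m = ℤ.<-irrefl refl (ℤ.≤-<-trans (z-≤ (ℕ.≰⇒> n≰m)) zsm<k)

  missed-in-gap : ∀ {k} N → z N < k → k < z 0 → (∀ n → z n ≢ k) →
                  ∃[ m ] (m ℕ.< N × z (suc m) < k × k < z m)
  missed-in-gap zero    z0<k k<z0 _      = ⊥-elim (ℤ.<-asym z0<k k<z0)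
  missed-in-gap {k} (suc N) zsN<k k<z0 missed with z N ℤ.<? k
  ... | yes zN<k = let m , m<N , gap = missed-in-gap N zN<k k<z0 missed in m , ℕ.m<n⇒m<1+n m<N , gap
  ... | no  zN≮k = N , ℕ.n<1+n N , zsN<k , ℤ.≤∧≢⇒< (ℤ.≮⇒≥ zN≮k) (≢-sym (missed N))

Pair : Set
Pair = ℤ × ℤ

endpoints : Pair → ℤ → Bool
endpoints (u , v) k = (k == u) xor (k == v)

inside : (ℤ → Bool) → Pair → Bool
inside c (u , v) = xorBetween c (sucℤ u) v

inside-point : ∀ {u v} x → u < v → x ≢ v →
               inside (_== x) (u , v) ≡ does (u ℤ.<? x) xor does (v ℤ.<? x)
inside-point {u} {v} x u<v x≢v with u ℤ.<? x | v ℤ.<? x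
... | no u≮x | yes v<x = ⊥-elim (u≮x (ℤ.<-trans u<v v<x))
... | no u≮x | no _    = xorBetween-false (_== x) (ℤ.i<j⇒suc[i]≤j u<v) λ k u<k _ →
  dec-false (k ℤ.≟ x) λ { refl → u≮x (ℤ.suc[i]≤j⇒i<j u<k) }
... | yes _  | yes v<x = xorBetween-false (_== x) (ℤ.i<j⇒suc[i]≤j u<v) λ k _ k<v →
  dec-false (k ℤ.≟ x) λ { refl → ℤ.<-asym k<v v<x }
... | yes u<x | no v≮x = begin
  xorBetween (_== x) (sucℤ u) v
    ≡⟨ xorBetween-split (_== x) (ℤ.i<j⇒suc[i]≤j u<x) (ℤ.<⇒≤ x<v) ⟩
  xorBetween (_== x) (sucℤ u) x xor xorBetween (_== x) x v
    ≡⟨ cong₂ _xor_ below (xorBetween-split (_== x) (ℤ.<⇒≤ (i<sucℤ[i] x)) (ℤ.i<j⇒suc[i]≤j x<v)) ⟩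
  false xor (xorBetween (_== x) x (sucℤ x) xor xorBetween (_== x) (sucℤ x) v)
    ≡⟨ cong₂ _xor_ (xorBetween-single (_== x) x) above ⟩
  (x == x) xor false
    ≡⟨ cong (_xor false) (dec-true (x ℤ.≟ x) refl) ⟩
  true ∎
  where
  open ≡-Reasoning
  x<v : x < v
  x<v = ℤ.≤∧≢⇒< (ℤ.≮⇒≥ v≮x) x≢v
  below : xorBetween (_== x) (sucℤ u) x ≡ false
  below = xorBetween-false (_== x) (ℤ.i<j⇒suc[i]≤j u<x) λ k _ k<x →
    dec-false (k ℤ.≟ x) λ { refl → ℤ.<-irrefl refl k<x }
  above : xorBetween (_== x) (sucℤ x) v ≡ false
  above = xorBetween-false (_== x) (ℤ.i<j⇒suc[i]≤j x<v) λ k x<k _ →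
    dec-false (k ℤ.≟ x) λ { refl → ℤ.<-irrefl refl (ℤ.suc[i]≤j⇒i<j x<k) }

inside-cong : ∀ {c c'} → c ≗ c' → ∀ s → inside c s ≡ inside c' s
inside-cong c≗c' (u , v) = xorFrom-cong c≗c' (sucℤ u) ∣ v - sucℤ u ∣

inside-xor : ∀ c c' s → inside (λ k → c k xor c' k) s ≡ inside c s xor inside c' s
inside-xor c c' (u , v) = xorFrom-xor c c' (sucℤ u) ∣ v - sucℤ u ∣

inside-∧ : ∀ d c s → inside (λ k → d ∧ c k) s ≡ d ∧ inside c s
inside-∧ d c (u , v) = xorFrom-∧ d c (sucℤ u) ∣ v - sucℤ u ∣

crossing : Pair → Pair → Bool
crossing s t = inside (endpoints s) t

crossing-self : ∀ {u v} → u < v → crossing (u , v) (u , v) ≡ false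
crossing-self {u} {v} u<v = xorBetween-false (endpoints (u , v)) (ℤ.i<j⇒suc[i]≤j u<v) λ k u<k k<v →
  cong₂ _xor_ (dec-false (k ℤ.≟ u) λ { refl → ℤ.<-irrefl refl (ℤ.suc[i]≤j⇒i<j u<k) })
              (dec-false (k ℤ.≟ v) λ { refl → ℤ.<-irrefl refl k<v })

crossing-formula : ∀ {u v u' v'} → u' < v' → u ≢ v' → v ≢ v' →
  crossing (u , v) (u' , v') ≡
  (does (u' ℤ.<? u) xor does (v' ℤ.<? u)) xor (does (u' ℤ.<? v) xor does (v' ℤ.<? v))
crossing-formula {u} {v} {u'} {v'} u'<v' u≢v' v≢v' =
  trans (inside-xor (_== u) (_== v) (u' , v'))
        (cong₂ _xor_ (inside-point u u'<v' u≢v') (inside-point v u'<v' v≢v'))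

crossing-sym : ∀ {u v u' v'} → u < v → u' < v' → u ≢ u' → u ≢ v' → v ≢ u' → v ≢ v' →
               crossing (u , v) (u' , v') ≡ crossing (u' , v') (u , v)
crossing-sym {u} {v} {u'} {v'} u<v u'<v' u≢u' u≢v' v≢u' v≢v' = begin
  crossing (u , v) (u' , v')
    ≡⟨ crossing-formula u'<v' u≢v' v≢v' ⟩
  (does (u' ℤ.<? u) xor does (v' ℤ.<? u)) xor (does (u' ℤ.<? v) xor does (v' ℤ.<? v))
    ≡⟨ solve 4 (λ a b c d → (a :+ b) :+ (c :+ d)
                := ((con true :+ a) :+ (con true :+ c)) :+ ((con true :+ b) :+ (con true :+ d))) refl
         (does (u' ℤ.<? u)) (does (v' ℤ.<? u)) (does (u' ℤ.<? v)) (does (v' ℤ.<? v)) ⟩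
  (not (does (u' ℤ.<? u)) xor not (does (u' ℤ.<? v))) xor (not (does (v' ℤ.<? u)) xor not (does (v' ℤ.<? v)))
    ≡⟨ sym (cong₂ _xor_ (cong₂ _xor_ (<?-flip (≢-sym u≢u')) (<?-flip (≢-sym v≢u')))
                        (cong₂ _xor_ (<?-flip (≢-sym u≢v')) (<?-flip (≢-sym v≢v')))) ⟩
  (does (u ℤ.<? u') xor does (v ℤ.<? u')) xor (does (u ℤ.<? v') xor does (v ℤ.<? v'))
    ≡⟨ sym (crossing-formula u<v (≢-sym v≢u') (≢-sym v≢v')) ⟩
  crossing (u' , v') (u , v) ∎
  where open ≡-Reasoning

Avoids : ℤ → Pair → Set
Avoids x (u , v) = x ≢ u × x ≢ v

DistinctEndpoints : List Pair → Set
DistinctEndpoints []            = ⊤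
DistinctEndpoints ((u , v) ∷ I) = u < v × All (Avoids u) I × All (Avoids v) I × DistinctEndpoints I

distinct⇒< : ∀ {I s} → DistinctEndpoints I → s ∈ I → proj₁ s < proj₂ s
distinct⇒< {(u , v) ∷ I} (u<v , _) (here refl)     = u<v
distinct⇒< {(u , v) ∷ I} (_ , _ , _ , dist) (there s∈I) = distinct⇒< dist s∈I

Marking : List Pair → Set
Marking = All (λ _ → Bool)

unmarked : ∀ I → Marking I
unmarked = All.universal (λ _ → false)

marked : ∀ {I} → Marking I → (Pair → Bool) → Bool
marked {[]}    []      g = false
marked {s ∷ I} (b ∷ m) g = (b ∧ g s) xor marked m g

flip : ∀ {s I} → s ∈ I → Marking I → Marking I
flip s∈I = All.updateAt s∈I not

marked-unmarked : ∀ I g → marked (unmarked I) g ≡ false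
marked-unmarked []      g = refl
marked-unmarked (s ∷ I) g = marked-unmarked I g

marked-false : ∀ {I} (m : Marking I) {g} → All (λ s → g s ≡ false) I → marked m g ≡ false
marked-false []      []             = refl
marked-false (b ∷ m) (g≡false ∷ gs) rewrite g≡false | Bool.∧-zeroʳ b = marked-false m gs

marked-flip : ∀ {s I} (s∈I : s ∈ I) (m : Marking I) g → marked (flip s∈I m) g ≡ marked m g xor g s
marked-flip (here refl) (b ∷ m) g =
  solve 3 (λ b x y → ((con true :+ b) :* x) :+ y := ((b :* x) :+ y) :+ x) refl b (g _) (marked m g)
marked-flip {s} {s' ∷ _} (there s∈I) (b ∷ m) g rewrite marked-flip s∈I m g =
  sym (Bool.xor-assoc (b ∧ g s') (marked m g) (g s))

inside-marked : ∀ {I} (m : Marking I) (g : Pair → ℤ → Bool) t →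
                inside (λ k → marked m (λ s → g s k)) t ≡ marked m (λ s → inside (g s) t)
inside-marked []      g (u , v) = xorFrom-false (λ _ → false) (sucℤ u) ∣ v - sucℤ u ∣ λ _ _ _ → refl
inside-marked {s ∷ I} (b ∷ m) g t = begin
  inside (λ k → (b ∧ g s k) xor marked m (λ s' → g s' k)) t
    ≡⟨ inside-xor (λ k → b ∧ g s k) (λ k → marked m (λ s' → g s' k)) t ⟩
  inside (λ k → b ∧ g s k) t xor inside (λ k → marked m (λ s' → g s' k)) t
    ≡⟨ cong₂ _xor_ (inside-∧ b (g s) t) (inside-marked m g t) ⟩
  (b ∧ inside (g s) t) xor marked m (λ s' → inside (g s') t) ∎
  where open ≡-Reasoning

crossings : ∀ {I} → Marking I → Pair → Bool
crossings m t = marked m (λ s → crossing s t)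

weight : (Pair → Bool) → ∀ {I} → Marking I → Bool
weight N {[]}    []      = false
weight N {s ∷ I} (b ∷ m) = (b ∧ (N s xor crossings m s)) xor weight N m

weight-unmarked : ∀ N I → weight N (unmarked I) ≡ false
weight-unmarked N []      = refl
weight-unmarked N (s ∷ I) = weight-unmarked N I

weight-flip : ∀ N {s I} → DistinctEndpoints I → (s∈I : s ∈ I) (m : Marking I) →
              weight N (flip s∈I m) ≡ weight N m xor (N s xor crossings m s)
weight-flip N {(u , v)} (u<v , _) (here refl) (b ∷ m) rewrite crossing-self u<v =
  solve 4 (λ b n x w → ((con true :+ b) :* (n :+ x)) :+ w
                       := ((b :* (n :+ x)) :+ w) :+ (n :+ ((b :* con false) :+ x))) refl
    b (N (u , v)) (crossings m (u , v)) (weight N m)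
weight-flip N {(u , v)} {s' ∷ I} (u'<v' , u'∉I , v'∉I , dist) (there s∈I) (b ∷ m) = begin
  (b ∧ (N s' xor crossings (flip s∈I m) s')) xor weight N (flip s∈I m)
    ≡⟨ cong₂ _xor_ (cong (λ x → b ∧ (N s' xor x)) (marked-flip s∈I m (λ t → crossing t s')))
                   (weight-flip N dist s∈I m) ⟩
  (b ∧ (N s' xor (crossings m s' xor crossing (u , v) s'))) xor (weight N m xor (N (u , v) xor crossings m (u , v)))
    ≡⟨ cong (λ c → (b ∧ (N s' xor (crossings m s' xor c))) xor _) crossing-swap ⟩
  (b ∧ (N s' xor (crossings m s' xor crossing s' (u , v)))) xor (weight N m xor (N (u , v) xor crossings m (u , v)))
    ≡⟨ solve 7 (λ b n' x' c w n y → (b :* (n' :+ (x' :+ c))) :+ (w :+ (n :+ y))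
                                   := ((b :* (n' :+ x')) :+ w) :+ (n :+ ((b :* c) :+ y))) refl
         b (N s') (crossings m s') (crossing s' (u , v)) (weight N m) (N (u , v)) (crossings m (u , v)) ⟩
  ((b ∧ (N s' xor crossings m s')) xor weight N m)
    xor (N (u , v) xor ((b ∧ crossing s' (u , v)) xor crossings m (u , v))) ∎
  where
  open ≡-Reasoning
  crossing-swap : crossing (u , v) s' ≡ crossing s' (u , v)
  crossing-swap with All.lookup u'∉I s∈I | All.lookup v'∉I s∈I
  ... | u'≢u , u'≢v | v'≢u , v'≢v =
    crossing-sym (distinct⇒< dist s∈I) u'<v' (≢-sym u'≢u) (≢-sym v'≢u) (≢-sym u'≢v) (≢-sym v'≢v)

xor-cancelˡ : ∀ x {a b} → x xor a ≡ x xor b → a ≡ b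
xor-cancelˡ false eq = eq
xor-cancelˡ true  eq = Bool.not-injective eq

marked-endpoints-head : ∀ {u v I} → u < v → All (Avoids u) I → ∀ b (m : Marking I) →
                        marked {(u , v) ∷ I} (b ∷ m) (λ s → endpoints s u) ≡ b
marked-endpoints-head {u} {v} u<v u∉I b m = begin
  (b ∧ ((u == u) xor (u == v))) xor marked m (λ s → endpoints s u)
    ≡⟨ cong₂ (λ e r → (b ∧ e) xor r)
             (cong₂ _xor_ (dec-true (u ℤ.≟ u) refl) (dec-false (u ℤ.≟ v) (ℤ.<⇒≢ u<v)))
             (marked-false m (All.map (λ { (u≢u' , u≢v') → cong₂ _xor_ (dec-false (u ℤ.≟ _) u≢u')
                                                                        (dec-false (u ℤ.≟ _) u≢v') }) u∉I)) ⟩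
  (b ∧ true) xor false
    ≡⟨ trans (Bool.xor-identityʳ _) (Bool.∧-identityʳ b) ⟩
  b ∎
  where open ≡-Reasoning

marking-injective : ∀ {I} → DistinctEndpoints I → (m m' : Marking I) →
                    (∀ k → marked m (λ s → endpoints s k) ≡ marked m' (λ s → endpoints s k)) → m ≡ m'
marking-injective {[]}          _                       []      []        _  = refl
marking-injective {(u , v) ∷ I} (u<v , u∉I , _ , dist) (b ∷ m) (b' ∷ m') eq = cong₂ _∷_ b≡b' m≡m'
  where
  b≡b' : b ≡ b'
  b≡b' = trans (sym (marked-endpoints-head u<v u∉I b m))
               (trans (eq u) (marked-endpoints-head u<v u∉I b' m'))
  m≡m' : m ≡ m'
  m≡m' = marking-injective dist m m' λ k →
    xor-cancelˡ (b ∧ endpoints (u , v) k) (trans (eq k) (cong (λ c → (c ∧ endpoints (u , v) k) xor _) (sym b≡b')))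

toggle : Pair → (ℤ → Bool) → ℤ → Bool
toggle s c k = c k xor endpoints s k

-- Walks list their latest step first, as steps does.
run : (ℤ → Bool) → List Pair → ℤ → Bool
run c []       = c
run c (s ∷ ps) = toggle s (run c ps)

cost : (ℤ → Bool) → List Pair → Bool
cost c []       = false
cost c (s ∷ ps) = inside (run c ps) s xor cost c ps

module _ {I : List Pair} where

  markingOf : ∀ {ps} → All (_∈ I) ps → Marking I
  markingOf []            = unmarked I
  markingOf (s∈I ∷ ps∈I) = flip s∈I (markingOf ps∈I)

  run-marking : ∀ c {ps} (ps∈I : All (_∈ I) ps) k →
                run c ps k ≡ c k xor marked (markingOf ps∈I) (λ s → endpoints s k)
  run-marking c []                      k =
    sym (trans (cong (c k xor_) (marked-unmarked I _)) (Bool.xor-identityʳ (c k)))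
  run-marking c {s ∷ ps} (s∈I ∷ ps∈I) k = begin
    run c ps k xor endpoints s k
      ≡⟨ cong (_xor endpoints s k) (run-marking c ps∈I k) ⟩
    (c k xor marked m (λ t → endpoints t k)) xor endpoints s k
      ≡⟨ Bool.xor-assoc (c k) _ _ ⟩
    c k xor (marked m (λ t → endpoints t k) xor endpoints s k)
      ≡⟨ cong (c k xor_) (sym (marked-flip s∈I m (λ t → endpoints t k))) ⟩
    c k xor marked (flip s∈I m) (λ t → endpoints t k) ∎
    where
    open ≡-Reasoning
    m = markingOf ps∈I

  cost-marking : DistinctEndpoints I → ∀ c {ps} (ps∈I : All (_∈ I) ps) →
                 cost c ps ≡ weight (inside c) (markingOf ps∈I)
  cost-marking dist c []                      = sym (weight-unmarked (inside c) I)
  cost-marking dist c {s ∷ ps} (s∈I ∷ ps∈I) = begin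
    inside (run c ps) s xor cost c ps
      ≡⟨ cong₂ _xor_ inside-run (cost-marking dist c ps∈I) ⟩
    (inside c s xor crossings m s) xor weight (inside c) m
      ≡⟨ Bool.xor-comm (inside c s xor crossings m s) (weight (inside c) m) ⟩
    weight (inside c) m xor (inside c s xor crossings m s)
      ≡⟨ sym (weight-flip (inside c) dist s∈I m) ⟩
    weight (inside c) (flip s∈I m) ∎
    where
    open ≡-Reasoning
    m = markingOf ps∈I
    inside-run : inside (run c ps) s ≡ inside c s xor crossings m s
    inside-run = begin
      inside (run c ps) s
        ≡⟨ inside-cong (run-marking c ps∈I) s ⟩
      inside (λ k → c k xor marked m (λ t → endpoints t k)) s
        ≡⟨ inside-xor c _ s ⟩
      inside c s xor inside (λ k → marked m (λ t → endpoints t k)) s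
        ≡⟨ cong (inside c s xor_) (inside-marked m endpoints s) ⟩
      inside c s xor crossings m s ∎

  cost-determined : DistinctEndpoints I → ∀ c {ps qs} (ps∈I : All (_∈ I) ps) (qs∈I : All (_∈ I) qs) →
                    run c ps ≗ run c qs → cost c ps ≡ cost c qs
  cost-determined dist c {ps} {qs} ps∈I qs∈I same-run = begin
    cost c ps                          ≡⟨ cost-marking dist c ps∈I ⟩
    weight (inside c) (markingOf ps∈I) ≡⟨ cong (weight (inside c)) same-marking ⟩
    weight (inside c) (markingOf qs∈I) ≡⟨ sym (cost-marking dist c qs∈I) ⟩
    cost c qs                          ∎
    where
    open ≡-Reasoning
    same-marking : markingOf ps∈I ≡ markingOf qs∈I
    same-marking = marking-injective dist (markingOf ps∈I) (markingOf qs∈I) λ k →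
      xor-cancelˡ (c k) (trans (sym (run-marking c ps∈I k)) (trans (same-run k) (run-marking c qs∈I k)))

toggle-first : ∀ {u v} → u < v → ∀ c → toggle (u , v) c u ≡ not (c u)
toggle-first {u} {v} u<v c
  rewrite dec-true (u ℤ.≟ u) refl | dec-false (u ℤ.≟ v) (ℤ.<⇒≢ u<v) = Bool.xor-comm (c u) true

toggle-second : ∀ {u v} → u < v → ∀ c → toggle (u , v) c v ≡ not (c v)
toggle-second {u} {v} u<v c
  rewrite dec-false (v ℤ.≟ u) (≢-sym (ℤ.<⇒≢ u<v)) | dec-true (v ℤ.≟ v) refl = Bool.xor-comm (c v) true

toggle-elsewhere : ∀ {u v k} → k ≢ u → k ≢ v → ∀ c → toggle (u , v) c k ≡ c k
toggle-elsewhere {u} {v} {k} k≢u k≢v c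
  rewrite dec-false (k ℤ.≟ u) k≢u | dec-false (k ℤ.≟ v) k≢v = Bool.xor-identityʳ (c k)

part-suc-≤ : ∀ {α} → Linked ℕ._≥_ α → ∀ n → part α (suc (suc n)) ℕ.≤ part α (suc n)
part-suc-≤ {[]}        _            n       = ℕ.z≤n
part-suc-≤ {a ∷ []}    _            n       = ℕ.z≤n
part-suc-≤ {a ∷ b ∷ α} (a≥b ∷ _)    zero    = a≥b
part-suc-≤ {a ∷ b ∷ α} (_ ∷ linked) (suc n) = part-suc-≤ linked n

part-antitone : ∀ {α} → Linked ℕ._≥_ α → ∀ {m n} → m ℕ.≤ n → part α (suc n) ℕ.≤ part α (suc m)
part-antitone linked {m} {n} m≤n with ℕ.m≤n⇒m<n∨m≡n m≤n
part-antitone linked {m} {suc n} _ | inj₁ (ℕ.s≤s m≤n) = ℕ.≤-trans (part-suc-≤ linked n) (part-antitone linked m≤n)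
... | inj₂ refl = ℕ.≤-refl

part-beyond : ∀ α {n} → length α ℕ.≤ n → part α (suc n) ≡ 0
part-beyond []      _             = refl
part-beyond (a ∷ α) (ℕ.s≤s ℓ≤n) = part-beyond α ℓ≤n

-- Rows are counted from 0: maya α n is the index of the vertical step of the boundary path at
-- the right end of row n (for n ≥ ℓ(α), of the vertical step from (0, -(n + 1)).
maya : List ℕ → ℕ → ℤ
maya α n = + part α (suc n) - + suc n

maya-step : ∀ {α} → Linked ℕ._≥_ α → ∀ n → maya α (suc n) < maya α n
maya-step {α} linked n
  rewrite ℤ.[+m]-[+n]≡m⊖n (part α (suc (suc n))) (suc (suc n)) | ℤ.[+m]-[+n]≡m⊖n (part α (suc n)) (suc n) =
  ℤ.≤-<-trans (ℤ.⊖-monoˡ-≤ (suc (suc n)) (part-suc-≤ linked n))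
              (ℤ.⊖-monoʳ->-< (part α (suc n)) (ℕ.n<1+n (suc n)))

maya-beyond : ∀ α {n} → length α ℕ.≤ n → maya α n ≡ -[1+ n ]
maya-beyond α ℓ≤n rewrite part-beyond α ℓ≤n = refl

Maya : List ℕ → ℤ → Set
Maya α k = ∃[ n ] maya α n ≡ k

maya-below-length : ∀ α {k} → k < - + length α → Maya α k
maya-below-length α {+ _}     k<-ℓ = ⊥-elim (ℤ.<-irrefl refl (ℤ.<-≤-trans k<-ℓ ℤ.neg-≤-pos))
maya-below-length α { -[1+ n ]} k<-ℓ = n , maya-beyond α (ℓ≤n (length α) k<-ℓ)
  where
  ℓ≤n : ∀ ℓ → -[1+ n ] < - + ℓ → ℓ ℕ.≤ n
  ℓ≤n zero    _             = ℕ.z≤n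
  ℓ≤n (suc ℓ) (ℤ.-<- ℓ<n) = ℓ<n

maya-beyond< : ∀ α {n} → length α ℕ.≤ n → maya α n < - + length α
maya-beyond< α ℓ≤n = subst (_< - + length α) (sym (maya-beyond α ℓ≤n)) (-[1+n]<-m ℓ≤n)

maya-within-length : ∀ α {n k} → maya α n ≡ k → - + length α ≤ k → n ℕ.< length α
maya-within-length α {n} refl -ℓ≤k with n ℕ.<? length α
... | yes n<ℓ = n<ℓ
... | no  n≮ℓ = ⊥-elim (ℤ.<-irrefl refl (ℤ.<-≤-trans (maya-beyond< α (ℕ.≮⇒≥ n≮ℓ)) -ℓ≤k))

maya? : ∀ α k → Dec (Maya α k)
maya? α k with k ℤ.<? - + length α
... | yes k<-ℓ = yes (maya-below-length α k<-ℓ)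
... | no  k≮-ℓ = Dec.map′ (λ (n , _ , eq) → n , eq)
                          (λ (n , eq) → n , maya-within-length α eq (ℤ.≮⇒≥ k≮-ℓ) , eq)
                          (ℕ.anyUpTo? (λ n → maya α n ℤ.≟ k) (length α))

particle : List ℕ → ℤ → Bool
particle α k = does (maya? α k)

particle-true : ∀ α {k} → Maya α k → particle α k ≡ true
particle-true α {k} = dec-true (maya? α k)

particle-false : ∀ α {k} → ¬ Maya α k → particle α k ≡ false
particle-false α {k} = dec-false (maya? α k)

particle-false⇒¬maya : ∀ α {k} → particle α k ≡ false → ¬ Maya α k
particle-false⇒¬maya α particle≡false m with trans (sym (particle-true α m)) particle≡false
... | ()

same-maya⇒same-particle : ∀ {α β k} → (Maya α k ⇔ Maya β k) → particle α k ≡ particle β k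
same-maya⇒same-particle {α} {β} {k} iff with maya? α k
... | yes m  = sym (particle-true β (Equivalence.to iff m))
... | no  ¬m = sym (particle-false β (¬m ∘ Equivalence.from iff))

module _ {β : List ℕ} (linked : Linked ℕ._≥_ β) where
  open StrictlyDecreasing (maya-step linked)

  one-particle-per-gap : ∀ n → xorBetween (particle β) (sucℤ (maya β (suc n))) (sucℤ (maya β n)) ≡ true
  one-particle-per-gap n = begin
    xorBetween (particle β) (sucℤ (maya β (suc n))) (sucℤ (maya β n))
      ≡⟨ xorBetween-split (particle β) (ℤ.i<j⇒suc[i]≤j (maya-step linked n)) (ℤ.<⇒≤ (i<sucℤ[i] (maya β n))) ⟩
    xorBetween (particle β) (sucℤ (maya β (suc n))) (maya β n)
      xor xorBetween (particle β) (maya β n) (sucℤ (maya β n))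
      ≡⟨ cong₂ _xor_ (xorBetween-false (particle β) (ℤ.i<j⇒suc[i]≤j (maya-step linked n)) λ k zsn<k k<zn →
                        particle-false β λ (n' , eq) → gap-missed (ℤ.suc[i]≤j⇒i<j zsn<k) k<zn n' eq)
                     (xorBetween-single (particle β) (maya β n)) ⟩
    false xor particle β (maya β n)
      ≡⟨ particle-true β (n , refl) ⟩
    true ∎
    where open ≡-Reasoning

  particles-between : ∀ j d → xorBetween (particle β) (sucℤ (maya β (j ℕ.+ d))) (sucℤ (maya β j)) ≡ parity d
  particles-between j zero rewrite ℕ.+-identityʳ j = xorBetween-empty (particle β) (sucℤ (maya β j))
  particles-between j (suc d) rewrite ℕ.+-suc j d = begin
    xorBetween (particle β) (sucℤ (maya β (suc (j ℕ.+ d)))) (sucℤ (maya β j))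
      ≡⟨ xorBetween-split (particle β) (ℤ.suc-mono (ℤ.<⇒≤ (maya-step linked (j ℕ.+ d))))
                                       (ℤ.suc-mono (z-≤ (ℕ.m≤m+n j d))) ⟩
    xorBetween (particle β) (sucℤ (maya β (suc (j ℕ.+ d)))) (sucℤ (maya β (j ℕ.+ d)))
      xor xorBetween (particle β) (sucℤ (maya β (j ℕ.+ d))) (sucℤ (maya β j))
      ≡⟨ cong₂ _xor_ (one-particle-per-gap (j ℕ.+ d)) (particles-between j d) ⟩
    not (parity d) ∎
    where open ≡-Reasoning

codeOne⇒¬maya : ∀ {α k} → Linked ℕ._≥_ α → CodeOne α k → ¬ Maya α k
codeOne⇒¬maya {α} linked (x , _ , refl , tailH p≤x) (n , eq) =
  ℤ.<-irrefl (trans eq (ℤ.+-identityʳ x)) (ℤ.≤-<-trans (z-≤ ℕ.z≤n) (ℤ.<-≤-trans maya₀<p p≤x))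
  where
  open StrictlyDecreasing (maya-step linked)
  maya₀<p : maya α 0 < + part α 1
  maya₀<p = subst (_< + part α 1) (sym (ℤ.[+m]-[+n]≡m⊖n (part α 1) 1)) (ℤ.m⊖1+n<m (part α 1) 1)
codeOne⇒¬maya linked (x , _ , refl , rowH {zero} () _ _ _)
codeOne⇒¬maya {α} linked (x , _ , refl , rowH {suc m} _ _ p'≤x x<p) (n , eq) =
  gap-missed below above n eq
  where
  open StrictlyDecreasing (maya-step linked)
  below : maya α (suc m) < x - + suc m
  below = ℤ.≤-<-trans (ℤ.+-monoˡ-≤ (- + suc (suc m)) p'≤x)
                      (ℤ.+-monoʳ-< x (ℤ.neg-mono-< (ℤ.+<+ (ℕ.n<1+n (suc m)))))
  above : x - + suc m < maya α m
  above = ℤ.+-monoˡ-< (- + suc m) x<p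

codeOne-tail : ∀ {α k} → maya α 0 < k → CodeOne α k
codeOne-tail {k = k} maya₀<k =
  k + 0ℤ , 0ℤ , trans (ℤ.+-identityʳ (k + 0ℤ)) (ℤ.+-identityʳ k) , tailH (a-sucℤ[s]<k⇒a≤k+s maya₀<k)

codeOne-row : ∀ {α k m} → m ℕ.< length α → maya α (suc m) < k → k < maya α m → CodeOne α k
codeOne-row {k = k} {m} m<ℓ below above =
  k + + suc m , - + suc m , [i+j]-j≡i k (+ suc m) ,
  rowH (ℕ.s≤s ℕ.z≤n) m<ℓ (a-sucℤ[s]<k⇒a≤k+s below) (k<a-s⇒k+s<a above)
  where
  [i+j]-j≡i : ∀ i j → (i + j) - j ≡ i
  [i+j]-j≡i = solve-∀

¬maya⇒codeOne : ∀ {α k} → Linked ℕ._≥_ α → ¬ Maya α k → CodeOne α k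
¬maya⇒codeOne {α} {k} linked ¬maya with maya α 0 ℤ.<? k
... | yes maya₀<k = codeOne-tail maya₀<k
... | no  maya₀≮k
  with StrictlyDecreasing.missed-in-gap (maya-step linked) (length α)
         (ℤ.<-≤-trans (maya-beyond< α ℕ.≤-refl) (ℤ.≮⇒≥ (¬maya ∘ maya-below-length α)))
         (ℤ.≤∧≢⇒< (ℤ.≮⇒≥ maya₀≮k) (λ k≡maya₀ → ¬maya (0 , sym k≡maya₀)))
         (λ n eq → ¬maya (n , eq))
...   | m , m<ℓ , below , above = codeOne-row m<ℓ below above

codeOne⇔particle-false : ∀ {α k} → Linked ℕ._≥_ α → CodeOne α k ⇔ (particle α k ≡ false)
codeOne⇔particle-false {α} linked =
  mk⇔ (particle-false α ∘ codeOne⇒¬maya linked) (¬maya⇒codeOne linked ∘ particle-false⇒¬maya α)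

codeDiffer⇔particle-differ : ∀ {α β k} → Linked ℕ._≥_ α → Linked ℕ._≥_ β →
                             CodeDiffer α β k ⇔ (particle α k ≢ particle β k)
codeDiffer⇔particle-differ {α} {β} {k} linkedα linkedβ = mk⇔
  (λ differ same → differ (mk⇔ (fromβ ∘ trans (sym same) ∘ toα) (fromα ∘ trans same ∘ toβ)))
  (λ differ codes → differ (same-false-iff (mk⇔ (toβ ∘ Equivalence.to codes ∘ fromα)
                                                (toα ∘ Equivalence.from codes ∘ fromβ))))
  where
  open Equivalence (codeOne⇔particle-false {k = k} linkedα) renaming (to to toα; from to fromα)
  open Equivalence (codeOne⇔particle-false {k = k} linkedβ) renaming (to to toβ; from to fromβ)
  same-false-iff : ∀ {a b} → (a ≡ false ⇔ b ≡ false) → a ≡ b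
  same-false-iff {true}  {true}  _   = refl
  same-false-iff {false} {false} _   = refl
  same-false-iff {true}  {false} iff with Equivalence.from iff refl
  ... | ()
  same-false-iff {false} {true}  iff with Equivalence.to iff refl
  ... | ()

toggle⇒stepPair : ∀ {α β u v} → Linked ℕ._≥_ α → Linked ℕ._≥_ β → u < v →
                  particle α ≗ toggle (u , v) (particle β) → StepPair β α u v
toggle⇒stepPair {α} {β} {u} {v} linkedα linkedβ u<v toggled =
  u<v , differs (toggle-first u<v (particle β)) , differs (toggle-second u<v (particle β)) , only-endpoints
  where
  module Differ {k} = Equivalence (codeDiffer⇔particle-differ {k = k} linkedα linkedβ)
  differs : ∀ {k} → toggle (u , v) (particle β) k ≡ not (particle β k) → CodeDiffer α β k
  differs {k} flipped = Differ.from λ same → Bool.not-¬ same (trans (toggled k) flipped)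
  only-endpoints : ∀ k → CodeDiffer α β k → k ≡ u ⊎ k ≡ v
  only-endpoints k differ with k ℤ.≟ u | k ℤ.≟ v
  ... | yes k≡u | _       = inj₁ k≡u
  ... | no  _   | yes k≡v = inj₂ k≡v
  ... | no  k≢u | no  k≢v = ⊥-elim (Differ.to differ (trans (toggled k) (toggle-elsewhere k≢u k≢v (particle β))))

adjacent⇒aligned : ∀ {i j i' j'} → Adjacent (i , j) (i' , j') → i ≡ i' ⊎ j ≡ j'
adjacent⇒aligned {i} {j} {i'} {j'} adj with i ℤ.≟ i' | j ℤ.≟ j'
... | yes i≡i' | _        = inj₁ i≡i'
... | no  _    | yes j≡j' = inj₂ j≡j'
... | no  i≢i' | no  j≢j' = ⊥-elim (ℕ.<-irrefl (sym adj) (ℕ.+-mono-≤ (distance-pos i≢i') (distance-pos j≢j')))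
  where
  distance-pos : ∀ {x y} → x ≢ y → 1 ℕ.≤ ∣ x - y ∣
  distance-pos {x} {y} x≢y = ℕ.n≢0⇒n>0 λ eq → x≢y (ℤ.i-j≡0⇒i≡j x y (ℤ.∣i∣≡0⇒i≡0 eq))

module BorderStrip {α β : List ℕ} (pα : IsPartition α) (pβ : IsPartition β) (strip : IsBorderStrip α β) where

  a b : ℕ → ℕ
  a n = part α (suc n)
  b n = part β (suc n)

  Met : ℕ → Set
  Met n = b n ℕ.< a n

  Met? : ∀ n → Dec (Met n)
  Met? n = b n ℕ.<? a n

  β⊆α : ∀ n → b n ℕ.≤ a n
  β⊆α n = proj₁ strip (suc n)

  cell : ∀ {i j n c} → i ≡ + suc n → j ≡ + c → b n ℕ.< c → c ℕ.≤ a n → InSkew α β i j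
  cell {n = n} {c} refl refl b<c c≤a =
    Equivalence.from Bool.T-∧ (ℕ.≤⇒≤ᵇ (subst (ℕ._≤ c) (ℕ.+-comm 1 (b n)) b<c) , ℕ.≤⇒≤ᵇ c≤a)

  cell⁻¹ : ∀ {i j} → InSkew α β i j → ∃[ n ] ∃[ c ] (i ≡ + suc n × j ≡ + c × b n ℕ.< c × c ℕ.≤ a n)
  cell⁻¹ {+ zero}             ()
  cell⁻¹ { -[1+ _ ]}          ()
  cell⁻¹ {+ suc n} { -[1+ _ ]} ()
  cell⁻¹ {+ suc n} {+ c}      in-strip with Equivalence.to Bool.T-∧ in-strip
  ... | b+1≤c , c≤a = n , c , refl , refl ,
        subst (ℕ._≤ c) (ℕ.+-comm (b n) 1) (ℕ.≤ᵇ⇒≤ _ _ b+1≤c) , ℕ.≤ᵇ⇒≤ _ _ c≤a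

  no-2×2 : ∀ n → a (suc n) ℕ.≤ suc (b n)
  no-2×2 n with a (suc n) ℕ.≤? suc (b n)
  ... | yes short   = short
  ... | no  too-long = ⊥-elim (proj₂ (proj₂ (proj₂ strip)) (+ suc n , + suc (b n) ,
        cell refl                   refl                      (ℕ.n<1+n (b n))  (ℕ.<⇒≤ b+1<a) ,
        cell (+x+1≡+suc[x] (suc n)) refl                      (ℕ.s≤s b'≤b)     (ℕ.<⇒≤ b+1<a') ,
        cell refl                   (+x+1≡+suc[x] (suc (b n))) (ℕ.m<n⇒m<1+n (ℕ.n<1+n (b n))) b+1<a ,
        cell (+x+1≡+suc[x] (suc n)) (+x+1≡+suc[x] (suc (b n))) (ℕ.m<n⇒m<1+n (ℕ.s≤s b'≤b)) b+1<a'))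
    where
    b+1<a' : suc (b n) ℕ.< a (suc n)
    b+1<a' = ℕ.≰⇒> too-long
    b+1<a : suc (b n) ℕ.< a n
    b+1<a = ℕ.<-≤-trans b+1<a' (part-suc-≤ (proj₂ pα) n)
    b'≤b : b (suc n) ℕ.≤ b n
    b'≤b = part-suc-≤ (proj₂ pβ) n

  reach-start : ∀ {i j q} → Reach α β (i , j) q → InSkew α β i j
  reach-start (here in-strip)       = in-strip
  reach-start (step in-strip _ _)   = in-strip

  -- A cell in a row ≤ n lies right of column b n, a cell in a lower row weakly left of
  -- a (suc n) ≤ b n; so no edge of the strip crosses below row n.
  reach-stays-above : ∀ {n} → a (suc n) ℕ.≤ b n → ∀ {i j q} → Reach α β (i , j) q →
                      i ≤ + suc n → proj₁ q ≤ + suc n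
  reach-stays-above gap (here _) i≤n = i≤n
  reach-stays-above {n} gap {i} {j} (step {c = i' , j'} in-strip adj rest) i≤n with i' ℤ.≤? + suc n
  ... | yes i'≤n = reach-stays-above gap rest i'≤n
  ... | no  i'≰n
    with cell⁻¹ {i} {j} in-strip | cell⁻¹ {i'} {j'} (reach-start rest) | adjacent⇒aligned {i} {j} {i'} {j'} adj
  ...   | _ , _ , _    , _    , _   , _    | _  , _  , _    , _    , _ , _     | inj₁ refl = ⊥-elim (i'≰n i≤n)
  ...   | r , c , refl , refl , b<c , _    | r' , _  , refl , refl , _ , c≤a' | inj₂ refl =
    ⊥-elim (ℕ.<-irrefl refl (ℕ.≤-<-trans (ℕ.≤-trans c≤a' (ℕ.≤-trans a'≤a gap)) (ℕ.≤-<-trans b≤b b<c)))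
    where
    r≤n : r ℕ.≤ n
    r≤n = ℕ.s≤s⁻¹ (ℤ.drop‿+≤+ i≤n)
    n<r' : n ℕ.< r'
    n<r' = ℕ.s≤s⁻¹ (ℤ.drop‿+<+ (ℤ.≰⇒> i'≰n))
    a'≤a : a r' ℕ.≤ a (suc n)
    a'≤a = part-antitone (proj₂ pα) n<r'
    b≤b : b n ℕ.≤ b r
    b≤b = part-antitone (proj₂ pβ) r≤n

  gap-disconnects : ∀ {r r' n} → Met r → Met r' → r ℕ.≤ n → n ℕ.< r' → b n ℕ.< a (suc n)
  gap-disconnects {r} {r'} {n} met met' r≤n n<r' with b n ℕ.<? a (suc n)
  ... | yes connected = connected
  ... | no  gap       = ⊥-elim (ℤ.<⇒≱ (ℤ.+<+ (ℕ.s≤s n<r'))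
        (reach-stays-above (ℕ.≮⇒≥ gap) (proj₁ (proj₂ (proj₂ strip)) (+ suc r) (+ a r) (+ suc r') (+ a r')
           (cell refl refl met ℕ.≤-refl) (cell refl refl met' ℕ.≤-refl))
           (ℤ.+≤+ (ℕ.s≤s r≤n))))

  record Rows : Set where
    field
      first last       : ℕ
      first≤last       : first ℕ.≤ last
      last<ℓ           : last ℕ.< length α
      first-met        : Met first
      last-met         : Met last
      unchanged-before : ∀ n → n ℕ.< first → a n ≡ b n
      unchanged-after  : ∀ n → last ℕ.< n → a n ≡ b n
      shifted          : ∀ n → first ℕ.≤ n → n ℕ.< last → a (suc n) ≡ suc (b n)

  met-bounded : ∀ n → Met n → n ℕ.< length α
  met-bounded n met with n ℕ.<? length α
  ... | yes n<ℓ = n<ℓ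
  ... | no  n≮ℓ = ⊥-elim (ℕ.n≮0 (subst (b n ℕ.<_) (part-beyond α (ℕ.≮⇒≥ n≮ℓ)) met))

  some-row-met : ∃[ n ] Met n
  some-row-met with proj₁ (proj₂ strip)
  ... | i , j , in-strip with cell⁻¹ {i} {j} in-strip
  ...   | n , _ , _ , _ , b<c , c≤a = n , ℕ.<-≤-trans b<c c≤a

  unmet⇒unchanged : ∀ n → ¬ Met n → a n ≡ b n
  unmet⇒unchanged n unmet = ℕ.≤-antisym (ℕ.≮⇒≥ unmet) (β⊆α n)

  abstract
    rows : Rows
    rows with some-row-met
    ... | r , met with least Met? met | greatest Met? (length α) met-bounded met
    ...   | j , met-j , none-before | m , met-m , none-after = record
      { first            = j
      ; last             = m
      ; first≤last       = ℕ.≮⇒≥ λ m<j → none-before m m<j met-m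
      ; last<ℓ           = met-bounded m met-m
      ; first-met        = met-j
      ; last-met         = met-m
      ; unchanged-before = λ n n<j → unmet⇒unchanged n (none-before n n<j)
      ; unchanged-after  = λ n m<n → unmet⇒unchanged n (none-after n m<n)
      ; shifted          = λ n j≤n n<m → ℕ.≤-antisym (no-2×2 n) (gap-disconnects met-j met-m j≤n n<m)
      }

  open Rows rows

  met-between : ∀ n → first ℕ.≤ n → n ℕ.≤ last → Met n
  met-between n first≤n n≤last with ℕ.m≤n⇒m<n∨m≡n n≤last
  ... | inj₂ refl   = last-met
  ... | inj₁ n<last = ℕ.<-≤-trans (ℕ.≤-reflexive (sym (shifted n first≤n n<last))) (part-suc-≤ (proj₂ pα) n)

  module Dα = StrictlyDecreasing (maya-step (proj₂ pα))
  module Dβ = StrictlyDecreasing (maya-step (proj₂ pβ))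

  u v : ℤ
  u = maya β last
  v = maya α first

  maya-unchanged : ∀ {n} → a n ≡ b n → maya α n ≡ maya β n
  maya-unchanged {n} eq = cong (λ x → + x - + suc n) eq

  maya-shifted : ∀ {n} → first ℕ.≤ n → n ℕ.< last → maya α (suc n) ≡ maya β n
  maya-shifted {n} first≤n n<last = begin
    + a (suc n) - + suc (suc n)    ≡⟨ cong (λ x → + x - + suc (suc n)) (shifted n first≤n n<last) ⟩
    + suc (b n) - + suc (suc n)    ≡⟨ ℤ.[+m]-[+n]≡m⊖n (suc (b n)) (suc (suc n)) ⟩
    suc (b n) ℤ.⊖ suc (suc n)      ≡⟨ ℤ.[1+m]⊖[1+n]≡m⊖n (b n) (suc n) ⟩
    b n ℤ.⊖ suc n                  ≡⟨ sym (ℤ.[+m]-[+n]≡m⊖n (b n) (suc n)) ⟩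
    + b n - + suc n                ∎
    where open ≡-Reasoning

  maya-met : ∀ {n} → Met n → maya β n < maya α n
  maya-met {n} met = ℤ.+-monoˡ-< (- + suc n) (ℤ.+<+ met)

  u<v : u < v
  u<v = ℤ.≤-<-trans (Dβ.z-≤ first≤last) (maya-met first-met)

  u∉α : ¬ Maya α u
  u∉α (n , eq) with last ℕ.<? n
  ... | yes last<n = ℤ.<-irrefl (trans (sym (maya-unchanged (unchanged-after n last<n))) eq) (Dβ.z-< last<n)
  ... | no  last≮n = ℤ.<-irrefl (sym eq) (ℤ.<-≤-trans (maya-met last-met) (Dα.z-≤ (ℕ.≮⇒≥ last≮n)))

  v∉β : ¬ Maya β v
  v∉β (n , eq) with n ℕ.<? first
  ... | yes n<first = ℤ.<-irrefl (sym (trans (maya-unchanged (unchanged-before n n<first)) eq)) (Dα.z-< n<first)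
  ... | no  n≮first = ℤ.<-irrefl eq (ℤ.≤-<-trans (Dβ.z-≤ (ℕ.≮⇒≥ n≮first)) (maya-met first-met))

  maya-α : ∀ n → maya α n ≡ v ⊎ Maya β (maya α n)
  maya-α n with ℕ.<-cmp n first
  ... | tri< n<first _ _ = inj₂ (n , sym (maya-unchanged (unchanged-before n n<first)))
  ... | tri≈ _ refl _    = inj₁ refl
  maya-α (suc n) | tri> _ _ first<1+n with last ℕ.<? suc n
  ... | yes last<1+n = inj₂ (suc n , sym (maya-unchanged (unchanged-after (suc n) last<1+n)))
  ... | no  last≮1+n = inj₂ (n , sym (maya-shifted (ℕ.s≤s⁻¹ first<1+n) (ℕ.≮⇒≥ last≮1+n)))

  maya-β : ∀ n → maya β n ≡ u ⊎ Maya α (maya β n)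
  maya-β n with n ℕ.<? first | ℕ.<-cmp n last
  ... | yes n<first | _              = inj₂ (n , maya-unchanged (unchanged-before n n<first))
  ... | no  n≮first | tri< n<last _ _ = inj₂ (suc n , maya-shifted (ℕ.≮⇒≥ n≮first) n<last)
  ... | no  _       | tri≈ _ refl _  = inj₁ refl
  ... | no  _       | tri> _ _ last<n = inj₂ (n , maya-unchanged (unchanged-after n last<n))

  -- A with on k ≟ u would also abstract the same test inside toggle, hence the helper.
  particles-toggled : particle α ≗ toggle (u , v) (particle β)
  particles-toggled k = by-cases k (k ℤ.≟ u) (k ℤ.≟ v)
    where
    open ≡-Reasoning
    by-cases : ∀ k → Dec (k ≡ u) → Dec (k ≡ v) → particle α k ≡ toggle (u , v) (particle β) k
    by-cases k (yes refl) _ = begin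
      particle α u            ≡⟨ particle-false α u∉α ⟩
      not true                ≡⟨ cong not (sym (particle-true β (last , refl))) ⟩
      not (particle β u)      ≡⟨ sym (toggle-first u<v (particle β)) ⟩
      toggle (u , v) (particle β) u ∎
    by-cases k (no _) (yes refl) = begin
      particle α v            ≡⟨ particle-true α (first , refl) ⟩
      not false               ≡⟨ cong not (sym (particle-false β v∉β)) ⟩
      not (particle β v)      ≡⟨ sym (toggle-second u<v (particle β)) ⟩
      toggle (u , v) (particle β) v ∎
    by-cases k (no k≢u) (no k≢v) =
      trans (same-maya⇒same-particle (mk⇔ to from)) (sym (toggle-elsewhere k≢u k≢v (particle β)))
      where
      to : Maya α k → Maya β k
      to (n , refl) = [ (λ eq → ⊥-elim (k≢v eq)) , id ] (maya-α n)
      from : Maya β k → Maya α k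
      from (n , refl) = [ (λ eq → ⊥-elim (k≢u eq)) , id ] (maya-β n)

  first+[last-first]≡last : first ℕ.+ (last ℕ.∸ first) ≡ last
  first+[last-first]≡last = ℕ.m+[n∸m]≡n first≤last

  rowMetᵇ : ℤ → Bool
  rowMetᵇ i = partℤ β i <ᵇ partℤ α i

  met⇒rowMetᵇ : ∀ n → Met n → rowMetᵇ (+ suc n) ≡ true
  met⇒rowMetᵇ n met = dec-true ((b n ℕ.+ 1) ℕ.≤? a n) (subst (ℕ._≤ a n) (ℕ.+-comm 1 (b n)) met)

  unchanged⇒¬rowMetᵇ : ∀ n → a n ≡ b n → rowMetᵇ (+ suc n) ≡ false
  unchanged⇒¬rowMetᵇ n a≡b = dec-false ((b n ℕ.+ 1) ℕ.≤? a n) λ b+1≤a →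
    ℕ.<-irrefl refl (subst (ℕ._≤ b n) (ℕ.+-comm (b n) 1) (subst (b n ℕ.+ 1 ℕ.≤_) a≡b b+1≤a))

  rows-met : rowsMet α β ≡ suc (last ℕ.∸ first)
  rows-met = begin
    count rowMetᵇ 1ℤ (length α)
      ≡⟨ cong (count rowMetᵇ 1ℤ) layout ⟩
    count rowMetᵇ 1ℤ (first ℕ.+ (met ℕ.+ rest))
      ≡⟨ count-+ rowMetᵇ 1ℤ first (met ℕ.+ rest) ⟩
    count rowMetᵇ 1ℤ first ℕ.+ count rowMetᵇ (+ suc first) (met ℕ.+ rest)
      ≡⟨ cong (count rowMetᵇ 1ℤ first ℕ.+_) (count-+ rowMetᵇ (+ suc first) met rest) ⟩
    count rowMetᵇ 1ℤ first ℕ.+ (count rowMetᵇ (+ suc first) met ℕ.+ count rowMetᵇ (+ suc (first ℕ.+ met)) rest)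
      ≡⟨ cong₂ ℕ._+_ before (cong₂ ℕ._+_ between after) ⟩
    0 ℕ.+ (met ℕ.+ 0)
      ≡⟨ ℕ.+-identityʳ met ⟩
    met ∎
    where
    open ≡-Reasoning
    met  = suc (last ℕ.∸ first)
    rest = length α ℕ.∸ suc last
    first+met≡1+last : first ℕ.+ met ≡ suc last
    first+met≡1+last = trans (ℕ.+-suc first (last ℕ.∸ first)) (cong suc first+[last-first]≡last)
    layout : length α ≡ first ℕ.+ (met ℕ.+ rest)
    layout = sym (begin
      first ℕ.+ (met ℕ.+ rest) ≡⟨ sym (ℕ.+-assoc first met rest) ⟩
      (first ℕ.+ met) ℕ.+ rest ≡⟨ cong (ℕ._+ rest) first+met≡1+last ⟩
      suc last ℕ.+ rest        ≡⟨ ℕ.m+[n∸m]≡n last<ℓ ⟩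
      length α                 ∎)
    before : count rowMetᵇ 1ℤ first ≡ 0
    before = count-false rowMetᵇ 1ℤ first λ n n<first → unchanged⇒¬rowMetᵇ n (unchanged-before n n<first)
    between : count rowMetᵇ (+ suc first) met ≡ met
    between = count-true rowMetᵇ (+ suc first) met λ i i<met →
      met⇒rowMetᵇ (first ℕ.+ i) (met-between (first ℕ.+ i) (ℕ.m≤m+n first i)
        (subst (first ℕ.+ i ℕ.≤_) first+[last-first]≡last (ℕ.+-monoʳ-≤ first (ℕ.s≤s⁻¹ i<met))))
    after : count rowMetᵇ (+ suc (first ℕ.+ met)) rest ≡ 0
    after = count-false rowMetᵇ (+ suc (first ℕ.+ met)) rest λ i _ →
      unchanged⇒¬rowMetᵇ (first ℕ.+ met ℕ.+ i) (unchanged-after _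
        (subst (λ x → last ℕ.< x ℕ.+ i) (sym first+met≡1+last) (ℕ.s≤s (ℕ.m≤m+n last i))))

  particles-inside : inside (particle β) (u , v) ≡ parity (last ℕ.∸ first)
  particles-inside = begin
    xorBetween (particle β) (sucℤ u) v
      ≡⟨ xorBetween-split (particle β) (ℤ.suc-mono (Dβ.z-≤ first≤last)) (ℤ.i<j⇒suc[i]≤j (maya-met first-met)) ⟩
    xorBetween (particle β) (sucℤ u) (sucℤ (maya β first)) xor xorBetween (particle β) (sucℤ (maya β first)) v
      ≡⟨ cong₂ _xor_ (subst (λ n → xorBetween (particle β) (sucℤ (maya β n)) (sucℤ (maya β first)) ≡ parity (last ℕ.∸ first))
                            first+[last-first]≡last (particles-between (proj₂ pβ) first (last ℕ.∸ first)))
                     (xorBetween-false (particle β) (ℤ.i<j⇒suc[i]≤j (maya-met first-met)) λ k above k<v →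
                        particle-false β λ (n , eq) → not-between k (ℤ.suc[i]≤j⇒i<j above) k<v n eq) ⟩
    parity (last ℕ.∸ first) xor false
      ≡⟨ Bool.xor-identityʳ _ ⟩
    parity (last ℕ.∸ first) ∎
    where
    open ≡-Reasoning
    not-between : ∀ k → maya β first < k → k < v → ∀ n → maya β n ≢ k
    not-between k above k<v n refl with n ℕ.<? first
    ... | yes n<first = ℤ.<-asym k<v (subst (v <_) (maya-unchanged (unchanged-before n n<first)) (Dα.z-< n<first))
    ... | no  n≮first = ℤ.<-irrefl refl (ℤ.≤-<-trans (Dβ.z-≤ (ℕ.≮⇒≥ n≮first)) above)

  particle-jump : ∃[ s ] (proj₁ s < proj₂ s × particle α ≗ toggle s (particle β)
                          × parity (htStrip α β) ≡ inside (particle β) s)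
  particle-jump =
    (u , v) , u<v , particles-toggled , trans (cong (λ r → parity (r ℕ.∸ 1)) rows-met) (sym particles-inside)

-- f stands for the pattern lambda used in IsIntervalSet, which cannot be named here.
unique-endpoints⇒distinct : ∀ {f : Pair → List ℤ} → (∀ {u v} → f (u , v) ≡ u ∷ v ∷ []) →
                            ∀ {I} → Unique (concatMap f I) → All (λ s → proj₁ s < proj₂ s) I →
                            DistinctEndpoints I
unique-endpoints⇒distinct f-pair {[]}          _    _                = tt
unique-endpoints⇒distinct {f} f-pair {(u , v) ∷ I} uniq (u<v ∷ ordered)
  with subst (λ xs → Unique (xs ++ concatMap f I)) f-pair uniq
... | (_ ∷ u∉I) ∷ v∉I ∷ uniq' = u<v , avoids u∉I , avoids v∉I , unique-endpoints⇒distinct f-pair uniq' ordered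
  where
  avoids : ∀ {x J} → All (x ≢_) (concatMap f J) → All (Avoids x) J
  avoids {J = []}            _   = []
  avoids {x} {(u' , v') ∷ J} x∉ with subst (λ xs → All (x ≢_) (xs ++ concatMap f J)) f-pair x∉
  ... | x≢u' ∷ x≢v' ∷ x∉J = (x≢u' , x≢v') ∷ avoids x∉J

tableau-partition : ∀ {μ λ'} → IsPartition μ → BST μ λ' → IsPartition λ'
tableau-partition pμ start              = pμ
tableau-partition pμ (extend _ _ pα _) = pα

record Walk {μ λ'} (I : List Pair) (T : BST μ λ') : Set where
  field
    pairs     : List Pair
    pairs∈I   : All (_∈ I) pairs
    run-pairs : particle λ' ≗ run (particle μ) pairs
    parity-ht : parity (ht T) ≡ cost (particle μ) pairs

tableau-walk : ∀ {μ λ' I} → IsPartition μ → (T : BST μ λ') →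
               (∀ {β α u v} → (β , α) ∈ steps T → StepPair β α u v → (u , v) ∈ I) → Walk I T
tableau-walk pμ start _ = record { pairs = [] ; pairs∈I = [] ; run-pairs = λ _ → refl ; parity-ht = refl }
tableau-walk {μ} pμ (extend {β} T α pα strip) steps∈I
  with tableau-walk pμ T (λ mem → steps∈I (there mem))
     | BorderStrip.particle-jump pα (tableau-partition pμ T) strip
... | walk | s , u<v , toggled , height = record
  { pairs     = s ∷ pairs
  ; pairs∈I   = s∈I ∷ pairs∈I
  ; run-pairs = λ k → trans (toggled k) (cong (_xor endpoints s k) (run-pairs k))
  ; parity-ht = begin
      parity (htStrip α β ℕ.+ ht T)
        ≡⟨ parity-+ (htStrip α β) (ht T) ⟩
      parity (htStrip α β) xor parity (ht T)
        ≡⟨ cong₂ _xor_ height parity-ht ⟩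
      inside (particle β) s xor cost (particle μ) pairs
        ≡⟨ cong (_xor cost (particle μ) pairs) (inside-cong run-pairs s) ⟩
      inside (run (particle μ) pairs) s xor cost (particle μ) pairs ∎
  }
  where
  open Walk walk
  open ≡-Reasoning
  s∈I = steps∈I (here refl) (toggle⇒stepPair (proj₂ pα) (proj₂ (tableau-partition pμ T)) u<v toggled)

corresponds⇒steps∈I : ∀ {μ λ' I} {T : BST μ λ'} → Corresponds T I →
                      ∀ {β α u v} → (β , α) ∈ steps T → StepPair β α u v → (u , v) ∈ I
corresponds⇒steps∈I corr mem step-pair = Equivalence.to (corr _ _) (Any.map (λ { refl → step-pair }) mem)

intervalSet⇒distinct : ∀ {λ' μ I} → IsIntervalSet λ' μ I → DistinctEndpoints I
intervalSet⇒distinct (_ , unique , intervals) =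
  unique-endpoints⇒distinct refl unique (All.map (λ { {u , v} (u<v , _) → u<v }) intervals)

lemma5p1 : (λ' μ : List ℕ) → IsPartition λ' → IsPartition μ → μ ⊆ₚ λ' →
    (I : List (ℤ × ℤ)) → IsIntervalSet λ' μ I →
    (T T' : BST μ λ') → Corresponds T I → Corresponds T' I →
    ht T % 2 ≡ ht T' % 2
lemma5p1 λ' μ _ pμ _ I intervalSet T T' corr corr' = parity⇒%2 {ht T} {ht T'} (begin
  parity (ht T)              ≡⟨ W.parity-ht ⟩
  cost (particle μ) W.pairs  ≡⟨ cost-determined (intervalSet⇒distinct intervalSet) (particle μ) W.pairs∈I W'.pairs∈I
                                  (λ k → trans (sym (W.run-pairs k)) (W'.run-pairs k)) ⟩
  cost (particle μ) W'.pairs ≡⟨ sym W'.parity-ht ⟩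
  parity (ht T')             ∎)
  where
  open ≡-Reasoning
  module W  = Walk (tableau-walk pμ T  (corresponds⇒steps∈I corr))
  module W' = Walk (tableau-walk pμ T' (corresponds⇒steps∈I corr'))
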